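{- Let $m>1$ be an integer. Define $sf(n,m)$ for integers $n$ by $sf(n,m)=0$ for $n<0$, $sf(0,m)=1$, and for $n>0$: $sf(n,m)=sf(n/m,m)$ if $n\equiv 0\pmod m$, and $sf(n,m)=sf(n-r,m)+sf(n-m,m)$ if $n\equiv r\pmod m$ with $0<r<m$. Let $nd(n,m)$ be the number of partitions of $n$ into parts that are powers of $m$ (i.e. parts in $\{1,m,m^2,\dots\}$) in which the multiplicity of each part that occurs is not divisible by $m$. Then for every integer $n\ge0$, $sf(n,m)=nd(n,m)$.
   Context: $sf(n,m)$ equals the number of semi-$m$-Fibonacci partitions of $n$; the recurrence given characterizes it. The empty partition is counted for $n=0$, so $nd(0,m)=1$. -}

module Defs where

open import Data.Nat using (ℕ; zero; suc; _+_; _*_; _∸_; _^_; _<ᵇ_; NonZero)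
open import Data.Nat.DivMod using (_/_; _%_)
open import Data.Nat.Divisibility using (_∣?_)
open import Data.Nat.Properties using (_≟_)
open import Data.Bool using (if_then_else_)
open import Data.List using (List; []; _∷_; map; concatMap; filter; length; upTo; zipWith)
open import Data.Nat.ListAction using (sum)
open import Data.List.Relation.Unary.All using (All; all?)
open import Data.Sum using (_⊎_)
open import Relation.Nullary using (¬_)
import Relation.Nullary
open import Relation.Nullary.Decidable using (_⊎-dec_; ¬?)
open import Relation.Binary.PropositionalEquality using (_≡_)

-- Since every recursive call goes
-- to a strictly smaller natural argument, fuel = n suffices.
-- Values at negative arguments (only n - m with n < m can occur) are 0.
sfF : (m : ℕ) .{{_ : NonZero m}} → (fuel n : ℕ) → ℕ
sfF m _       zero    = 1
sfF m zero    (suc n) = 0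
sfF m (suc f) (suc n) with suc n % m
... | zero   = sfF m f (suc n / m)
... | suc r' = sfF m f (suc n ∸ suc r')
             + (if suc n <ᵇ m then 0 else sfF m f (suc n ∸ m))

sf : (n m : ℕ) .{{_ : NonZero m}} → ℕ
sf n m = sfF m n n

vecs : (len b : ℕ) → List (List ℕ)
vecs zero    b = [] ∷ []
vecs (suc l) b = concatMap (λ c → map (c ∷_) (vecs l b)) (upTo (suc b))

-- The candidate parts 1, m, m², …, mⁿ (every power of m that is ≤ n,
-- for m > 1, is among them; they are pairwise distinct for m > 1).
powers : (m n : ℕ) → List ℕ
powers m n = map (m ^_) (upTo (suc n))

-- A partition of n into parts that are powers of m is given by its
-- multiplicity list (c₀, …, cₙ): cᵢ = multiplicity of the part mⁱ,
-- with Σ cᵢ mⁱ = n (so each cᵢ ≤ n).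
powPartitions : (m n : ℕ) → List (List ℕ)
powPartitions m n =
  filter (λ cs → sum (zipWith _*_ cs (powers m n)) ≟ n) (vecs (suc n) n)

GoodMult : ℕ → ℕ → Set
GoodMult m c = c ≡ 0 ⊎ ¬ (m Data.Nat.Divisibility.∣ c)

goodMult? : (m c : ℕ) → Relation.Nullary.Dec (GoodMult m c)
goodMult? m c = (c ≟ 0) ⊎-dec ¬? (m ∣? c)

nd : (n m : ℕ) → ℕ
nd n m = length (filter (λ cs → all? (goodMult? m) cs) (powPartitions m n))

{-# OPTIONS --safe #-}
-- A partition of n into powers of m is its multiplicity list (c₀, c₁, …), read as
-- n = c₀ + m (c₁ + m (c₂ + …)).  The multiplicity c₀ of the part 1 must be ≡ n (mod m).
-- If m ∣ n, the only good choice is c₀ = 0, which leaves a partition of n / m.  Otherwise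
-- c₀ = n mod m again leaves a partition of n / m, while the choices c₀ ≥ m correspond, by
-- deleting m parts equal to 1, to the partitions of n − m.  Since n − (n mod m) = m (n / m),
-- this is the recurrence of sf, and both sides agree by strong induction on n.
module Submission where

open import Defs
open import Data.Nat using (ℕ; zero; suc; _+_; _*_; _∸_; _^_; _<ᵇ_; _≤_; _<_; s≤s; s≤s⁻¹; z<s; s<s; NonZero)
open import Data.Nat.Properties
open import Data.Nat.DivMod using (_/_; _%_; m≡m%n+[m/n]*n; [m+kn]%n≡m%n; m%n<n; m%n≤m; m<n⇒m%n≡m; m*n/n≡m; 0/n≡0; m/n<m; m/n≤m; m*[n/m]≡n)
open import Data.Nat.Divisibility using (_∣_; _∤_; _∣?_; n∣m*n; m∣m*n; ∣-refl; ∣m∣n⇒∣m+n; ∣m+n∣m⇒∣n; ∣m∸n∣n⇒∣m; >⇒∤; _∣0; m%n≡0⇒n∣m; n∣m⇒m%n≡0)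
open import Data.Bool using (if_then_else_)
open import Data.List using (List; []; _∷_; _++_; map; concatMap; filter; length; upTo; applyUpTo; zipWith)
open import Data.List.Properties using (filter-++; length-++; filter-none; filter-≐; map-upTo)
open import Data.Nat.ListAction using (sum)
open import Data.List.Relation.Unary.All as All using (All; []; _∷_; all?; universal)
open import Data.List.Relation.Unary.All.Properties using (map⁺; concat⁺)
open import Data.Nat.Induction using (<-rec)
open import Data.Product using (_×_; _,_; map₁)
open import Data.Sum using (inj₁; inj₂)
open import Function using (_∘_; id; _⇔_; mk⇔; Equivalence)
open import Relation.Nullary using (¬_; Dec; yes; no; contradiction)
open import Relation.Nullary.Decidable using (_×-dec_; dec-true; dec-false)
open import Relation.Unary using (Decidable)
open import Relation.Unary.Properties using (_∩?_)
open import Relation.Binary.PropositionalEquality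

module _ {A : Set} {P Q : A → Set} (P? : Decidable P) (Q? : Decidable Q) where

  filter-filter : ∀ xs → filter P? (filter Q? xs) ≡ filter (Q? ∩? P?) xs
  filter-filter [] = refl
  filter-filter (x ∷ xs) with Q? x
  ... | no _  = filter-filter xs
  ... | yes _ with P? x
  ...   | yes _ = cong (x ∷_) (filter-filter xs)
  ...   | no _  = filter-filter xs

  filter-cong-All : ∀ {xs} → All (λ x → P x ⇔ Q x) xs → filter P? xs ≡ filter Q? xs
  filter-cong-All {[]}     []           = refl
  filter-cong-All {x ∷ xs} (P⇔Q ∷ P⇔Qs) with P? x | Q? x
  ... | yes _ | yes _ = cong (x ∷_) (filter-cong-All P⇔Qs)
  ... | no _  | no _  = filter-cong-All P⇔Qs
  ... | yes p | no ¬q = contradiction (Equivalence.to P⇔Q p) ¬q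
  ... | no ¬p | yes q = contradiction (Equivalence.from P⇔Q q) ¬p

module _ {A B : Set} {P : A → Set} (P? : Decidable P) where

  length-filter-map : (f : B → A) → ∀ xs → length (filter P? (map f xs)) ≡ length (filter (P? ∘ f) xs)
  length-filter-map f [] = refl
  length-filter-map f (x ∷ xs) with P? (f x)
  ... | yes _ = cong suc (length-filter-map f xs)
  ... | no _  = length-filter-map f xs

  length-filter-concatMap : (f : B → List A) → ∀ xs →
                            length (filter P? (concatMap f xs)) ≡ sum (map (length ∘ filter P? ∘ f) xs)
  length-filter-concatMap f [] = refl
  length-filter-concatMap f (x ∷ xs) = begin
    length (filter P? (f x ++ concatMap f xs))                     ≡⟨ cong length (filter-++ P? (f x) _) ⟩
    length (filter P? (f x) ++ filter P? (concatMap f xs))         ≡⟨ length-++ (filter P? (f x)) ⟩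
    length (filter P? (f x)) + length (filter P? (concatMap f xs)) ≡⟨ cong (length (filter P? (f x)) +_) (length-filter-concatMap f xs) ⟩
    sum (map (length ∘ filter P? ∘ f) (x ∷ xs))                    ∎
    where open ≡-Reasoning

∑ : ℕ → (ℕ → ℕ) → ℕ
∑ zero    h = 0
∑ (suc N) h = h 0 + ∑ N (h ∘ suc)

sum-map-applyUpTo : ∀ (h f : ℕ → ℕ) N → sum (map h (applyUpTo f N)) ≡ ∑ N (h ∘ f)
sum-map-applyUpTo h f zero    = refl
sum-map-applyUpTo h f (suc N) = cong (h (f 0) +_) (sum-map-applyUpTo h (f ∘ suc) N)

∑-cong : ∀ N {h k : ℕ → ℕ} → (∀ i → h i ≡ k i) → ∑ N h ≡ ∑ N k
∑-cong zero    h≗k = refl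
∑-cong (suc N) h≗k = cong₂ _+_ (h≗k 0) (∑-cong N (h≗k ∘ suc))

∑-+ : ∀ a N (h : ℕ → ℕ) → ∑ (a + N) h ≡ ∑ a h + ∑ N (h ∘ (a +_))
∑-+ zero    N h = refl
∑-+ (suc a) N h = trans (cong (h 0 +_) (∑-+ a N (h ∘ suc))) (sym (+-assoc (h 0) _ _))

∑-zero : ∀ N {h : ℕ → ℕ} → (∀ i → i < N → h i ≡ 0) → ∑ N h ≡ 0
∑-zero zero    h≡0 = refl
∑-zero (suc N) h≡0 = cong₂ _+_ (h≡0 0 z<s) (∑-zero N (λ i i<N → h≡0 (suc i) (s<s i<N)))

∑-single : ∀ N {r} (h : ℕ → ℕ) → r < N → (∀ i → i < N → i ≢ r → h i ≡ 0) → ∑ N h ≡ h r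
∑-single (suc N) {zero} h _ h≡0 =
  trans (cong (h 0 +_) (∑-zero N (λ i i<N → h≡0 (suc i) (s<s i<N) λ ()))) (+-identityʳ (h 0))
∑-single (suc N) {suc r} h (s<s r<N) h≡0 =
  trans (cong (_+ ∑ N (h ∘ suc)) (h≡0 0 z<s λ ()))
        (∑-single N (h ∘ suc) r<N (λ i i<N i≢r → h≡0 (suc i) (s<s i<N) (i≢r ∘ suc-injective)))

∑-vanishing-tail : ∀ {M N} (h : ℕ → ℕ) → M ≤ N → (∀ i → M ≤ i → h i ≡ 0) → ∑ N h ≡ ∑ M h
∑-vanishing-tail {M} {N} h M≤N h≡0 = begin
  ∑ N h                                   ≡⟨ cong (λ L → ∑ L h) (m+[n∸m]≡n M≤N) ⟨
  ∑ (M + (N ∸ M)) h                       ≡⟨ ∑-+ M (N ∸ M) h ⟩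
  ∑ M h + ∑ (N ∸ M) (h ∘ (M +_))          ≡⟨ cong (∑ M h +_) (∑-zero (N ∸ M) (λ i _ → h≡0 (M + i) (m≤m+n M i))) ⟩
  ∑ M h + 0                               ≡⟨ +-identityʳ (∑ M h) ⟩
  ∑ M h                                   ∎
  where open ≡-Reasoning

vecs-length : ∀ k b → All (λ cs → length cs ≡ k) (vecs k b)
vecs-length zero    b = refl ∷ []
vecs-length (suc k) b = concat⁺ (map⁺ (universal (λ _ → map⁺ (All.map (cong suc) (vecs-length k b))) (upTo (suc b))))

module _ (m : ℕ) .{{_ : NonZero m}} where

  value : List ℕ → ℕ
  value []       = 0
  value (c ∷ cs) = c + m * value cs

  IsRep : ℕ → List ℕ → Set
  IsRep n cs = value cs ≡ n × All (GoodMult m) cs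

  isRep? : ∀ n → Decidable (IsRep n)
  isRep? n cs = (value cs ≟ n) ×-dec all? (goodMult? m) cs

  reps : (k b n : ℕ) → ℕ
  reps k b n = length (filter (isRep? n) (vecs k b))

  sum-zipWith-*-geometric : (h : ℕ → ℕ) → (∀ i → h (suc i) ≡ m * h i) →
                            ∀ cs → sum (zipWith _*_ cs (applyUpTo h (length cs))) ≡ h 0 * value cs
  sum-zipWith-*-geometric h h-geometric []       = sym (*-zeroʳ (h 0))
  sum-zipWith-*-geometric h h-geometric (c ∷ cs) = begin
    c * h 0 + sum (zipWith _*_ cs (applyUpTo (h ∘ suc) (length cs)))
      ≡⟨ cong (c * h 0 +_) (sum-zipWith-*-geometric (h ∘ suc) (h-geometric ∘ suc) cs) ⟩
    c * h 0 + h 1 * value cs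
      ≡⟨ cong (λ x → c * h 0 + x * value cs) (trans (h-geometric 0) (*-comm m (h 0))) ⟩
    c * h 0 + h 0 * m * value cs
      ≡⟨ cong₂ _+_ (*-comm c (h 0)) (*-assoc (h 0) m (value cs)) ⟩
    h 0 * c + h 0 * (m * value cs)
      ≡⟨ *-distribˡ-+ (h 0) c (m * value cs) ⟨
    h 0 * (c + m * value cs) ∎
    where open ≡-Reasoning

  sum-zipWith-powers : ∀ {n} cs → length cs ≡ suc n → sum (zipWith _*_ cs (powers m n)) ≡ value cs
  sum-zipWith-powers {n} cs len≡1+n = begin
    sum (zipWith _*_ cs (map (m ^_) (upTo (suc n))))      ≡⟨ cong (sum ∘ zipWith _*_ cs) (map-upTo (m ^_) (suc n)) ⟩
    sum (zipWith _*_ cs (applyUpTo (m ^_) (suc n)))       ≡⟨ cong (sum ∘ zipWith _*_ cs ∘ applyUpTo (m ^_)) len≡1+n ⟨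
    sum (zipWith _*_ cs (applyUpTo (m ^_) (length cs)))   ≡⟨ sum-zipWith-*-geometric (m ^_) (λ _ → refl) cs ⟩
    1 * value cs                                          ≡⟨ *-identityˡ (value cs) ⟩
    value cs                                              ∎
    where open ≡-Reasoning

  headCount : (k b n c : ℕ) → ℕ
  headCount k b n c = length (filter (isRep? n ∘ (c ∷_)) (vecs k b))

  reps-suc : ∀ k b n → reps (suc k) b n ≡ ∑ (suc b) (headCount k b n)
  reps-suc k b n = begin
    length (filter (isRep? n) (concatMap (λ c → map (c ∷_) (vecs k b)) (upTo (suc b))))
      ≡⟨ length-filter-concatMap (isRep? n) (λ c → map (c ∷_) (vecs k b)) (upTo (suc b)) ⟩
    sum (map (λ c → length (filter (isRep? n) (map (c ∷_) (vecs k b)))) (upTo (suc b)))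
      ≡⟨ sum-map-applyUpTo (λ c → length (filter (isRep? n) (map (c ∷_) (vecs k b)))) id (suc b) ⟩
    ∑ (suc b) (λ c → length (filter (isRep? n) (map (c ∷_) (vecs k b))))
      ≡⟨ ∑-cong (suc b) (λ c → length-filter-map (isRep? n) (c ∷_) (vecs k b)) ⟩
    ∑ (suc b) (headCount k b n) ∎
    where open ≡-Reasoning

  residue-good : ∀ n → GoodMult m (n % m)
  residue-good n with n % m | m%n<n n m
  ... | zero  | _   = inj₁ refl
  ... | suc r | r<m = inj₂ (>⇒∤ r<m)

  nondivisible-digit-good : ∀ {c q n} → m ∤ n → c + m * q ≡ n → GoodMult m c
  nondivisible-digit-good {q = q} m∤n c+mq≡n = inj₂ λ m∣c → m∤n (subst (m ∣_) c+mq≡n (∣m∣n⇒∣m+n m∣c (m∣m*n q)))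

  digit-below-m-is-residue : ∀ {c q n} → c < m → c + m * q ≡ n → c ≡ n % m
  digit-below-m-is-residue {c} {q} {n} c<m c+mq≡n = begin
    c               ≡⟨ m<n⇒m%n≡m c<m ⟨
    c % m           ≡⟨ [m+kn]%n≡m%n c q m ⟨
    (c + q * m) % m ≡⟨ cong (λ x → (c + x) % m) (*-comm q m) ⟩
    (c + m * q) % m ≡⟨ cong (_% m) c+mq≡n ⟩
    n % m           ∎
    where open ≡-Reasoning

  module _ (k b : ℕ) where

    headCount-≡ : ∀ {n c} q → GoodMult m c → c + m * q ≡ n → headCount k b n c ≡ reps k b q
    headCount-≡ {n} {c} q good-c c+mq≡n = cong length (filter-≐ (isRep? n ∘ (c ∷_)) (isRep? q) (to , from) (vecs k b))
      where
      to : ∀ {cs} → IsRep n (c ∷ cs) → IsRep q cs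
      to (c+mv≡n , _ ∷ good-cs) = *-cancelˡ-≡ _ q m (+-cancelˡ-≡ c _ _ (trans c+mv≡n (sym c+mq≡n))) , good-cs
      from : ∀ {cs} → IsRep q cs → IsRep n (c ∷ cs)
      from (refl , good-cs) = c+mq≡n , good-c ∷ good-cs

    headCount-≡0 : ∀ {n c} → (∀ q → GoodMult m c → c + m * q ≢ n) → headCount k b n c ≡ 0
    headCount-≡0 {n} {c} no-rep = cong length (filter-none (isRep? n ∘ (c ∷_)) (universal rejected (vecs k b)))
      where
      rejected : ∀ cs → ¬ IsRep n (c ∷ cs)
      rejected cs (c+mv≡n , good-c ∷ _) = no-rep (value cs) good-c c+mv≡n

    headCount-residue : ∀ n → headCount k b n (n % m) ≡ reps k b (n / m)
    headCount-residue n = headCount-≡ (n / m) (residue-good n)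
      (trans (cong (n % m +_) (*-comm m (n / m))) (sym (m≡m%n+[m/n]*n n m)))

    headCount-nonresidue : ∀ {n c} → c < m → c ≢ n % m → headCount k b n c ≡ 0
    headCount-nonresidue c<m c≢n%m = headCount-≡0 λ _ _ c+mq≡n → c≢n%m (digit-below-m-is-residue c<m c+mq≡n)

    headCount-beyond : ∀ {n c} → n < c → headCount k b n c ≡ 0
    headCount-beyond {c = c} n<c = headCount-≡0 λ q _ c+mq≡n → <⇒≱ n<c (subst (c ≤_) c+mq≡n (m≤m+n c (m * q)))

    headCount-divisible : ∀ {n c} → m ∣ n → c ≢ 0 → headCount k b n c ≡ 0
    headCount-divisible {c = c} m∣n c≢0 = headCount-≡0 λ
      { q (inj₁ c≡0)  _      → c≢0 c≡0
      ; q (inj₂ m∤c) c+mq≡n → m∤c (∣m+n∣m⇒∣n (subst (m ∣_) (sym (trans (+-comm (m * q) c) c+mq≡n)) m∣n) (m∣m*n q))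
      }

    headCount-shift : ∀ {n} c → m ∤ n → m ≤ n → headCount k b n (m + c) ≡ headCount k b (n ∸ m) c
    headCount-shift {n} c m∤n m≤n = cong length (filter-≐ (isRep? n ∘ (m + c ∷_)) (isRep? (n ∸ m) ∘ (c ∷_)) (to , from) (vecs k b))
      where
      m∤n∸m : m ∤ n ∸ m
      m∤n∸m m∣n∸m = m∤n (∣m∸n∣n⇒∣m m m≤n m∣n∸m ∣-refl)
      to : ∀ {cs} → IsRep n (m + c ∷ cs) → IsRep (n ∸ m) (c ∷ cs)
      to {cs} (eq , _ ∷ good-cs) = c+mv≡n∸m , nondivisible-digit-good m∤n∸m c+mv≡n∸m ∷ good-cs
        where
        c+mv≡n∸m : c + m * value cs ≡ n ∸ m
        c+mv≡n∸m = trans (sym (m+n∸m≡n m _)) (cong (_∸ m) (trans (sym (+-assoc m c _)) eq))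
      from : ∀ {cs} → IsRep (n ∸ m) (c ∷ cs) → IsRep n (m + c ∷ cs)
      from {cs} (eq , _ ∷ good-cs) = m+c+mv≡n , nondivisible-digit-good m∤n m+c+mv≡n ∷ good-cs
        where
        m+c+mv≡n : m + c + m * value cs ≡ n
        m+c+mv≡n = trans (+-assoc m c _) (trans (cong (m +_) eq) (m+[n∸m]≡n m≤n))

  reps-divisible : ∀ k b {n} → m ∣ n → reps (suc k) b n ≡ reps k b (n / m)
  reps-divisible k b {n} m∣n = begin
    reps (suc k) b n              ≡⟨ reps-suc k b n ⟩
    ∑ (suc b) (headCount k b n)   ≡⟨ ∑-single (suc b) (headCount k b n) z<s (λ _ _ c≢0 → headCount-divisible k b m∣n c≢0) ⟩
    headCount k b n 0             ≡⟨ headCount-≡ k b (n / m) (inj₁ refl) (m*[n/m]≡n m∣n) ⟩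
    reps k b (n / m)              ∎
    where open ≡-Reasoning

  reps-zero : ∀ k b → reps k b 0 ≡ 1
  reps-zero zero    b = refl
  reps-zero (suc k) b = trans (reps-divisible k b (m ∣0)) (trans (cong (reps k b) (0/n≡0 m)) (reps-zero k b))

  reps-below-m : ∀ k b {n} → n < m → n ≤ b → reps (suc k) b n ≡ reps k b (n / m)
  reps-below-m k b {n} n<m n≤b = begin
    reps (suc k) b n              ≡⟨ reps-suc k b n ⟩
    ∑ (suc b) (headCount k b n)   ≡⟨ ∑-single (suc b) (headCount k b n) (s≤s (≤-trans (m%n≤m n m) n≤b)) vanishes ⟩
    headCount k b n (n % m)       ≡⟨ headCount-residue k b n ⟩
    reps k b (n / m)              ∎
    where
    open ≡-Reasoning
    vanishes : ∀ c → c < suc b → c ≢ n % m → headCount k b n c ≡ 0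
    vanishes c _ c≢n%m with c <? m
    ... | yes c<m = headCount-nonresidue k b c<m c≢n%m
    ... | no  c≮m = headCount-beyond k b (<-≤-trans n<m (≮⇒≥ c≮m))

  reps-above-m : ∀ k b {n} → m ∤ n → m ≤ n → n ≤ b →
                      reps (suc k) b n ≡ reps k b (n / m) + reps (suc k) b (n ∸ m)
  reps-above-m k b {n} m∤n m≤n n≤b = begin
    reps (suc k) b n
      ≡⟨ reps-suc k b n ⟩
    ∑ (suc b) (headCount k b n)
      ≡⟨ cong (λ N → ∑ N (headCount k b n)) (m+[n∸m]≡n m≤1+b) ⟨
    ∑ (m + (suc b ∸ m)) (headCount k b n)
      ≡⟨ ∑-+ m (suc b ∸ m) (headCount k b n) ⟩
    ∑ m (headCount k b n) + ∑ (suc b ∸ m) (headCount k b n ∘ (m +_))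
      ≡⟨ cong₂ _+_ (∑-single m (headCount k b n) (m%n<n n m) (λ _ → headCount-nonresidue k b))
                   (∑-cong (suc b ∸ m) (λ c → headCount-shift k b c m∤n m≤n)) ⟩
    headCount k b n (n % m) + ∑ (suc b ∸ m) (headCount k b (n ∸ m))
      ≡⟨ cong₂ _+_ (headCount-residue k b n)
                   (sym (∑-vanishing-tail (headCount k b (n ∸ m)) (m∸n≤m (suc b) m)
                          (λ c b+1∸m≤c → headCount-beyond k b (<-≤-trans (∸-monoˡ-< (s≤s n≤b) m≤n) b+1∸m≤c)))) ⟩
    reps k b (n / m) + ∑ (suc b) (headCount k b (n ∸ m))
      ≡⟨ cong (reps k b (n / m) +_) (reps-suc k b (n ∸ m)) ⟨
    reps k b (n / m) + reps (suc k) b (n ∸ m)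
      ∎
    where
    open ≡-Reasoning
    m≤1+b : m ≤ suc b
    m≤1+b = ≤-trans m≤n (≤-trans n≤b (n≤1+n b))

nd≡reps : ∀ m .{{_ : NonZero m}} n → nd n m ≡ reps m (suc n) n n
nd≡reps m n = cong length (trans (filter-filter _ _ (vecs (suc n) n)) (filter-cong-All _ (isRep? m n)
  (All.map (λ {cs} len≡1+n → mk⇔ (map₁ (trans (sym (sum-zipWith-powers m cs len≡1+n))))
                                 (map₁ (trans (sum-zipWith-powers m cs len≡1+n))))
           (vecs-length (suc n) n))))

module _ (m : ℕ) .{{_ : NonZero m}} (1<m : 1 < m) where

  sfF-fuel-irrelevant : ∀ {f g} n → n ≤ f → n ≤ g → sfF m f n ≡ sfF m g n
  sfF-fuel-irrelevant zero _ _ = refl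
  sfF-fuel-irrelevant {suc f} {suc g} (suc n) (s≤s n≤f) (s≤s n≤g) with suc n % m
  ... | zero   = sfF-fuel-irrelevant (suc n / m) (≤-trans quotient≤n n≤f) (≤-trans quotient≤n n≤g)
    where
    quotient≤n : suc n / m ≤ n
    quotient≤n = <⇒≤pred (m/n<m (suc n) m 1<m)
  ... | suc r = cong₂ _+_ (sfF-fuel-irrelevant (n ∸ r) (≤-trans (m∸n≤m n r) n≤f) (≤-trans (m∸n≤m n r) n≤g))
                          (cong (if suc n <ᵇ m then 0 else_) (sfF-fuel-irrelevant (suc n ∸ m) (≤-trans n+1∸m≤n n≤f) (≤-trans n+1∸m≤n n≤g)))
    where
    n+1∸m≤n : suc n ∸ m ≤ n
    n+1∸m≤n = ∸-monoʳ-≤ (suc n) (<⇒≤ 1<m)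

  sf-suc-divisible : ∀ n → suc n % m ≡ 0 → sf (suc n) m ≡ sf (suc n / m) m
  sf-suc-divisible n eq rewrite eq = sfF-fuel-irrelevant (suc n / m) (<⇒≤pred (m/n<m (suc n) m 1<m)) ≤-refl

  sf-suc-residue : ∀ n r → suc n % m ≡ suc r →
                   sf (suc n) m ≡ sf (n ∸ r) m + (if suc n <ᵇ m then 0 else sf (suc n ∸ m) m)
  sf-suc-residue n r eq rewrite eq =
    cong₂ _+_ (sfF-fuel-irrelevant (n ∸ r) (m∸n≤m n r) ≤-refl)
              (cong (if suc n <ᵇ m then 0 else_) (sfF-fuel-irrelevant (suc n ∸ m) (∸-monoʳ-≤ (suc n) (<⇒≤ 1<m)) ≤-refl))

  sf-divisible : ∀ n .{{_ : NonZero n}} → m ∣ n → sf n m ≡ sf (n / m) m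
  sf-divisible (suc n) m∣n = sf-suc-divisible n (n∣m⇒m%n≡0 (suc n) m m∣n)

  sf-multiple : ∀ q → sf (q * m) m ≡ sf q m
  sf-multiple zero        = refl
  sf-multiple q@(suc _) =
    trans (sf-divisible (q * m) {{m*n≢0 q m}} (n∣m*n q)) (cong (λ x → sf x m) (m*n/n≡m q m))

  sf-nondivisible : ∀ {n} → m ∤ n → sf n m ≡ sf (n / m) m + (if n <ᵇ m then 0 else sf (n ∸ m) m)
  sf-nondivisible {zero}  m∤n = contradiction (m ∣0) m∤n
  sf-nondivisible {suc n} m∤n = by-residue (suc n % m) refl
    where
    by-residue : ∀ r → suc n % m ≡ r → sf (suc n) m ≡ sf (suc n / m) m + (if suc n <ᵇ m then 0 else sf (suc n ∸ m) m)
    by-residue zero    n+1%m≡0 = contradiction (m%n≡0⇒n∣m (suc n) m n+1%m≡0) m∤n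
    by-residue (suc r) n+1%m≡r+1 = begin
      sf (suc n) m                            ≡⟨ sf-suc-residue n r n+1%m≡r+1 ⟩
      sf (n ∸ r) m + rest                     ≡⟨ cong (λ x → sf x m + rest) n∸r≡q*m ⟩
      sf (suc n / m * m) m + rest             ≡⟨ cong (_+ rest) (sf-multiple (suc n / m)) ⟩
      sf (suc n / m) m + rest                 ∎
      where
      open ≡-Reasoning
      rest = if suc n <ᵇ m then 0 else sf (suc n ∸ m) m
      n∸r≡q*m : n ∸ r ≡ suc n / m * m
      n∸r≡q*m = trans (cong (_∸ r) (suc-injective (trans (m≡m%n+[m/n]*n (suc n) m) (cong (_+ suc n / m * m) n+1%m≡r+1))))
                      (m+n∸m≡n r (suc n / m * m))

  sf-below-m : ∀ {n} → m ∤ n → n < m → sf n m ≡ sf (n / m) m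
  sf-below-m {n} m∤n n<m = trans (sf-nondivisible m∤n)
    (trans (cong (λ t → sf (n / m) m + (if t then 0 else sf (n ∸ m) m)) (dec-true (n <? m) n<m)) (+-identityʳ _))

  sf-above-m : ∀ {n} → m ∤ n → m ≤ n → sf n m ≡ sf (n / m) m + sf (n ∸ m) m
  sf-above-m {n} m∤n m≤n = trans (sf-nondivisible m∤n)
    (cong (λ t → sf (n / m) m + (if t then 0 else sf (n ∸ m) m)) (dec-false (n <? m) (≤⇒≯ m≤n)))

  reps≡sf : ∀ n {k b} → n < k → n ≤ b → reps m k b n ≡ sf n m
  reps≡sf = <-rec (λ n → ∀ {k b} → n < k → n ≤ b → reps m k b n ≡ sf n m) step
    where
    step : ∀ n → (∀ {x} → x < n → ∀ {k b} → x < k → x ≤ b → reps m k b x ≡ sf x m) →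
           ∀ {k b} → n < k → n ≤ b → reps m k b n ≡ sf n m
    step zero        _  {k} {b} _ _ = reps-zero m k b
    step n@(suc _) ih {suc k} {b} n<1+k n≤b = by-cases (m ∣? n) (n <? m)
      where
      n/m<n : n / m < n
      n/m<n = m/n<m n m 1<m
      ih-quotient : reps m k b (n / m) ≡ sf (n / m) m
      ih-quotient = ih n/m<n (<-≤-trans n/m<n (s≤s⁻¹ n<1+k)) (≤-trans (m/n≤m n m) n≤b)
      by-cases : Dec (m ∣ n) → Dec (n < m) → reps m (suc k) b n ≡ sf n m
      by-cases (yes m∣n) _ =
        trans (reps-divisible m k b m∣n) (trans ih-quotient (sym (sf-divisible n m∣n)))
      by-cases (no m∤n) (yes n<m) =
        trans (reps-below-m m k b n<m n≤b) (trans ih-quotient (sym (sf-below-m m∤n n<m)))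
      by-cases (no m∤n) (no n≮m) =
        trans (reps-above-m m k b m∤n m≤n n≤b) (trans (cong₂ _+_ ih-quotient ih-rest) (sym (sf-above-m m∤n m≤n)))
        where
        m≤n : m ≤ n
        m≤n = ≮⇒≥ n≮m
        n∸m<n : n ∸ m < n
        n∸m<n = ∸-monoʳ-< (<-trans z<s 1<m) m≤n
        ih-rest : reps m (suc k) b (n ∸ m) ≡ sf (n ∸ m) m
        ih-rest = ih n∸m<n (<-trans n∸m<n n<1+k) (≤-trans (<⇒≤ n∸m<n) n≤b)

theorem3 : (m : ℕ) .{{_ : NonZero m}} → 1 < m → (n : ℕ) → sf n m ≡ nd n m
theorem3 m 1<m n = sym (trans (nd≡reps m n) (reps≡sf m 1<m n (n<1+n n) ≤-refl))
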